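{- Let $\mathcal{O} = \mathbb{Z}[2^{1/3}]$ and let $I$ be a primitive ideal of $\mathcal{O}$, i.e. a nonzero ideal such that $\mathcal{O}/I$ is cyclic as an abelian group; let $m = [\mathcal{O}:I]$. Then $I$ has a unique $\mathbb{Z}$-basis $\omega_1,\omega_2,\omega_3$ of the form $$\begin{pmatrix} \omega_1 \\ \omega_2 \\ \omega_3 \end{pmatrix} = \begin{pmatrix} m & 0 & 0 \\ -\nu & 1 & 0 \\ -\nu^2 & 0 & 1 \end{pmatrix} \begin{pmatrix} 1 \\ 2^{1/3} \\ 2^{2/3} \end{pmatrix},$$ where $\nu$ is a root of the congruence $X^3 \equiv 2 \pmod m$; here uniqueness is understood with $\nu$ and $\nu^2$ regarded as residue classes modulo $m$. Conversely, given a positive integer $m$ and $\nu \pmod m$ with $\nu^3 \equiv 2 \pmod m$, the lattice in $\mathcal{O}$ with $\mathbb{Z}$-basis $m,\ -\nu + 2^{1/3},\ -\nu^2 + 2^{2/3}$ is a primitive ideal of $\mathcal{O}$.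
   Context: $\mathcal{O} = \mathbb{Z}[2^{1/3}]$ is the ring of integers of $\mathbb{Q}(2^{1/3})$, with $\mathbb{Z}$-basis $1, 2^{1/3}, 2^{2/3}$. An ideal $I$ of $\mathcal{O}$ is called primitive if $\mathcal{O}/I$ is a cyclic abelian group. -}

module Defs where

open import Data.Nat using (ℕ)
open import Data.Integer as ℤ using (ℤ; +_; -[1+_])
open import Data.Integer.Divisibility using (_∣_)
open import Data.Fin using (Fin)
open import Data.Product using (Σ; ∃; _×_; _,_)
open import Relation.Binary.PropositionalEquality using (_≡_)
open import Relation.Nullary using (¬_)

-- An element a + b·θ + c·θ² of 𝒪 = ℤ[θ], θ = 2^{1/3}, in the ℤ-basis 1, θ, θ².
record 𝒪 : Set where
  constructor ⟨_,_,_⟩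
  field
    a b c : ℤ
open 𝒪 public

infixl 6 _⊕_ _⊖_
infixl 7 _⊗_

_⊕_ : 𝒪 → 𝒪 → 𝒪
⟨ a , b , c ⟩ ⊕ ⟨ d , e , f ⟩ = ⟨ a ℤ.+ d , b ℤ.+ e , c ℤ.+ f ⟩

⊝_ : 𝒪 → 𝒪
⊝ ⟨ a , b , c ⟩ = ⟨ ℤ.- a , ℤ.- b , ℤ.- c ⟩

_⊖_ : 𝒪 → 𝒪 → 𝒪
x ⊖ y = x ⊕ (⊝ y)

-- multiplication using θ³ = 2
_⊗_ : 𝒪 → 𝒪 → 𝒪
⟨ a , b , c ⟩ ⊗ ⟨ d , e , f ⟩ =
  ⟨ a ℤ.* d ℤ.+ + 2 ℤ.* (b ℤ.* f ℤ.+ c ℤ.* e)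
  , a ℤ.* e ℤ.+ b ℤ.* d ℤ.+ + 2 ℤ.* (c ℤ.* f)
  , a ℤ.* f ℤ.+ b ℤ.* e ℤ.+ c ℤ.* d ⟩

ι : ℤ → 𝒪
ι k = ⟨ k , + 0 , + 0 ⟩

𝟎 : 𝒪
𝟎 = ι (+ 0)

θ θ² : 𝒪
θ  = ⟨ + 0 , + 1 , + 0 ⟩
θ² = ⟨ + 0 , + 0 , + 1 ⟩

_·_ : ℤ → 𝒪 → 𝒪
k · x = ι k ⊗ x

Subset𝒪 : Set₁
Subset𝒪 = 𝒪 → Set

record IsIdeal (I : Subset𝒪) : Set where
  field
    zero∈ : I 𝟎
    add∈  : ∀ {x y} → I x → I y → I (x ⊕ y)
    mul∈  : ∀ r {x} → I x → I (r ⊗ x)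

NonzeroIdeal : Subset𝒪 → Set
NonzeroIdeal I = IsIdeal I × ∃ λ x → I x × ¬ (x ≡ 𝟎)

_≡[_]_ : 𝒪 → Subset𝒪 → 𝒪 → Set
x ≡[ I ] y = I (x ⊖ y)

QuotientCyclic : Subset𝒪 → Set
QuotientCyclic I = ∃ λ g → ∀ x → ∃ λ (k : ℤ) → x ≡[ I ] (k · g)

Primitive : Subset𝒪 → Set
Primitive I = NonzeroIdeal I × QuotientCyclic I

-- [𝒪 : I] = m : 𝒪/I has exactly m elements, i.e. there is a complete
-- system of m pairwise incongruent representatives
Index : Subset𝒪 → ℕ → Set
Index I m = Σ (Fin m → 𝒪) λ r →
    (∀ i j → r i ≡[ I ] r j → i ≡ j)
  × (∀ x → ∃ λ i → x ≡[ I ] r i)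

comb : ℤ → ℤ → ℤ → 𝒪 → 𝒪 → 𝒪 → 𝒪
comb x y z ω₁ ω₂ ω₃ = x · ω₁ ⊕ y · ω₂ ⊕ z · ω₃

IsZBasis : Subset𝒪 → 𝒪 → 𝒪 → 𝒪 → Set
IsZBasis I ω₁ ω₂ ω₃ =
    (I ω₁ × I ω₂ × I ω₃)
  × (∀ v → I v → ∃ λ x → ∃ λ y → ∃ λ z → v ≡ comb x y z ω₁ ω₂ ω₃)
  × (∀ x y z → comb x y z ω₁ ω₂ ω₃ ≡ 𝟎 → (x ≡ + 0 × y ≡ + 0 × z ≡ + 0))

Span : 𝒪 → 𝒪 → 𝒪 → Subset𝒪
Span ω₁ ω₂ ω₃ v = ∃ λ x → ∃ λ y → ∃ λ z → v ≡ comb x y z ω₁ ω₂ ω₃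

infix 4 _≡_[mod_]
_≡_[mod_] : ℤ → ℤ → ℕ → Set
x ≡ y [mod m ] = (+ m) ∣ (x ℤ.- y)

ω₁ : ℕ → 𝒪
ω₁ m = ι (+ m)

ω₂ : ℤ → 𝒪
ω₂ ν = ι (ℤ.- ν) ⊕ θ

ω₃ : ℤ → 𝒪
ω₃ μ = ι (ℤ.- μ) ⊕ θ²

{-# OPTIONS --safe #-}
module Submission where

-- If 𝒪/I is cyclic with generator g, then 1 ≡ a g and g² ≡ b g give g ≡ g·a g ≡ a b g ≡ b, so
-- every element of 𝒪 is congruent to an integer modulo I. Residues modulo a positive integer
-- d ∈ I separate a complete residue system, so d ≥ m, while by pigeonhole some positive d ≤ m
-- lies in I; hence I ∩ ℤ = mℤ. Writing θ ≡ ν, the elements m, θ − ν and θ² − ν² lie in I,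
-- so does ν³ − 2 = (ν − θ)(θ² + νθ + ν²), and a + bθ + cθ² ∈ I exactly when m divides
-- a + bν + cν²; this gives the basis and its uniqueness. Conversely a + bθ + cθ² ↦ a + bν + cν²
-- is multiplicative modulo ν³ − 2, so when m ∣ ν³ − 2 the elements whose image is divisible by
-- m form an ideal: the given lattice, whose quotient is generated by 1.

open import Defs
open import Data.Empty using (⊥-elim)
open import Data.Fin using (Fin; toℕ; fromℕ<)
open import Data.Fin.Patterns using (0F; 1F; 2F; 3F; 4F; 5F; 6F; 7F; 8F)
import Data.Fin.Properties as Finₚ
open import Data.Integer using (ℤ; +_; _+_; _*_; _-_; -_)
open import Data.Integer.Divisibility using (_∣_)
open import Data.Integer.Divisibility.Signed as Signed using (divides)
open import Data.Integer.DivMod using (_%ℕ_; _/ℕ_; n%ℕd<d; a≡a%ℕn+[a/ℕn]*n)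
import Data.Integer.Properties as ℤₚ
open import Data.Integer.Tactic.RingSolver using (ring; solve-∀)
open import Data.Nat as ℕ using (ℕ; NonZero; zero; suc; _∸_)
import Data.Nat.Properties as ℕₚ
open import Data.Product using (∃; _×_; _,_; proj₁; proj₂)
open import Data.Sum using (fromInj₁)
open import Data.Vec using (Vec; _∷_; [])
open import Function using (_∘_)
open import Relation.Binary.PropositionalEquality
import Tactic.RingSolver.NonReflective ring as ℤ-Solver
open ℤ-Solver using (Expr; Κ; Ι)
  renaming (_⊕_ to _+ᴱ_; _⊗_ to _*ᴱ_; ⊝_ to -ᴱ_)
open ℤ-Solver.Ops using (⟦_⟧; ⟦_⇓⟧; prove)

infixl 6 _-ᴱ_ _⊕ᴱ_ _⊖ᴱ_
infixl 7 _⊗ᴱ_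

_-ᴱ_ : ∀ {n} → Expr ℤ n → Expr ℤ n → Expr ℤ n
p -ᴱ q = p +ᴱ (-ᴱ q)

-- Each
-- operation repeats the formula of its counterpart on 𝒪, so evaluation commutes with it
-- definitionally and an identity in 𝒪 reduces to three identities checked by the ring solver.
record 𝒪-Expr (n : ℕ) : Set where
  constructor ⟪_,_,_⟫
  field
    ea eb ec : Expr ℤ n
open 𝒪-Expr

𝒪-var : ∀ {n} → Fin n → Fin n → Fin n → 𝒪-Expr n
𝒪-var i j k = ⟪ Ι i , Ι j , Ι k ⟫

ιᴱ : ∀ {n} → Expr ℤ n → 𝒪-Expr n
ιᴱ k = ⟪ k , Κ (+ 0) , Κ (+ 0) ⟫

θᴱ θ²ᴱ : ∀ {n} → 𝒪-Expr n
θᴱ  = ⟪ Κ (+ 0) , Κ (+ 1) , Κ (+ 0) ⟫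
θ²ᴱ = ⟪ Κ (+ 0) , Κ (+ 0) , Κ (+ 1) ⟫

_⊕ᴱ_ : ∀ {n} → 𝒪-Expr n → 𝒪-Expr n → 𝒪-Expr n
⟪ a , b , c ⟫ ⊕ᴱ ⟪ d , e , f ⟫ = ⟪ a +ᴱ d , b +ᴱ e , c +ᴱ f ⟫

⊝ᴱ_ : ∀ {n} → 𝒪-Expr n → 𝒪-Expr n
⊝ᴱ ⟪ a , b , c ⟫ = ⟪ -ᴱ a , -ᴱ b , -ᴱ c ⟫

_⊖ᴱ_ : ∀ {n} → 𝒪-Expr n → 𝒪-Expr n → 𝒪-Expr n
x ⊖ᴱ y = x ⊕ᴱ (⊝ᴱ y)

_⊗ᴱ_ : ∀ {n} → 𝒪-Expr n → 𝒪-Expr n → 𝒪-Expr n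
⟪ a , b , c ⟫ ⊗ᴱ ⟪ d , e , f ⟫ =
  ⟪ a *ᴱ d +ᴱ Κ (+ 2) *ᴱ (b *ᴱ f +ᴱ c *ᴱ e)
  , a *ᴱ e +ᴱ b *ᴱ d +ᴱ Κ (+ 2) *ᴱ (c *ᴱ f)
  , a *ᴱ f +ᴱ b *ᴱ e +ᴱ c *ᴱ d ⟫

_·ᴱ_ : ∀ {n} → Expr ℤ n → 𝒪-Expr n → 𝒪-Expr n
k ·ᴱ x = ιᴱ k ⊗ᴱ x

ω₂ᴱ ω₃ᴱ : ∀ {n} → Expr ℤ n → 𝒪-Expr n
ω₂ᴱ ν = ιᴱ (-ᴱ ν) ⊕ᴱ θᴱ
ω₃ᴱ μ = ιᴱ (-ᴱ μ) ⊕ᴱ θ²ᴱ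

combᴱ : ∀ {n} → Expr ℤ n → Expr ℤ n → Expr ℤ n → 𝒪-Expr n → 𝒪-Expr n → 𝒪-Expr n → 𝒪-Expr n
combᴱ x y z ω ω′ ω″ = x ·ᴱ ω ⊕ᴱ y ·ᴱ ω′ ⊕ᴱ z ·ᴱ ω″

⟦_⟧𝒪 : ∀ {n} → 𝒪-Expr n → Vec ℤ n → 𝒪
⟦ ⟪ a , b , c ⟫ ⟧𝒪 ρ = ⟨ ⟦ a ⟧ ρ , ⟦ b ⟧ ρ , ⟦ c ⟧ ρ ⟩

𝒪-ext : ∀ {x y} → a x ≡ a y → b x ≡ b y → c x ≡ c y → x ≡ y
𝒪-ext refl refl refl = refl

prove𝒪 : ∀ {n} (ρ : Vec ℤ n) (x y : 𝒪-Expr n) →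
  ⟦ ea x ⇓⟧ ρ ≡ ⟦ ea y ⇓⟧ ρ → ⟦ eb x ⇓⟧ ρ ≡ ⟦ eb y ⇓⟧ ρ → ⟦ ec x ⇓⟧ ρ ≡ ⟦ ec y ⇓⟧ ρ →
  ⟦ x ⟧𝒪 ρ ≡ ⟦ y ⟧𝒪 ρ
prove𝒪 ρ x y a≡ b≡ c≡ =
  𝒪-ext (prove ρ (ea x) (ea y) a≡) (prove ρ (eb x) (eb y) b≡) (prove ρ (ec x) (ec y) c≡)

-1⊗x≡⊝x : ∀ x → ι (- + 1) ⊗ x ≡ ⊝ x
-1⊗x≡⊝x ⟨ a , b , c ⟩ = prove𝒪 (a ∷ b ∷ c ∷ []) (ιᴱ (-ᴱ Κ (+ 1)) ⊗ᴱ x) (⊝ᴱ x) refl refl refl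
  where
  x : 𝒪-Expr 3
  x = 𝒪-var 0F 1F 2F

⊝[x⊖y]≡y⊖x : ∀ x y → ⊝ (x ⊖ y) ≡ y ⊖ x
⊝[x⊖y]≡y⊖x ⟨ a , b , c ⟩ ⟨ d , e , f ⟩ =
  prove𝒪 (a ∷ b ∷ c ∷ d ∷ e ∷ f ∷ []) (⊝ᴱ (x ⊖ᴱ y)) (y ⊖ᴱ x) refl refl refl
  where
  x y : 𝒪-Expr 6
  x = 𝒪-var 0F 1F 2F
  y = 𝒪-var 3F 4F 5F

[x⊖y]⊕[y⊖z]≡x⊖z : ∀ x y z → (x ⊖ y) ⊕ (y ⊖ z) ≡ x ⊖ z
[x⊖y]⊕[y⊖z]≡x⊖z ⟨ a , b , c ⟩ ⟨ d , e , f ⟩ ⟨ p , q , r ⟩ =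
  prove𝒪 (a ∷ b ∷ c ∷ d ∷ e ∷ f ∷ p ∷ q ∷ r ∷ []) ((x ⊖ᴱ y) ⊕ᴱ (y ⊖ᴱ z)) (x ⊖ᴱ z) refl refl refl
  where
  x y z : 𝒪-Expr 9
  x = 𝒪-var 0F 1F 2F
  y = 𝒪-var 3F 4F 5F
  z = 𝒪-var 6F 7F 8F

x⊖[x⊖y]≡y : ∀ x y → x ⊖ (x ⊖ y) ≡ y
x⊖[x⊖y]≡y ⟨ a , b , c ⟩ ⟨ d , e , f ⟩ =
  prove𝒪 (a ∷ b ∷ c ∷ d ∷ e ∷ f ∷ []) (x ⊖ᴱ (x ⊖ᴱ y)) y refl refl refl
  where
  x y : 𝒪-Expr 6
  x = 𝒪-var 0F 1F 2F
  y = 𝒪-var 3F 4F 5F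

ι-⊖ : ∀ k l → ι k ⊖ ι l ≡ ι (k - l)
ι-⊖ k l = prove𝒪 (k ∷ l ∷ []) (ιᴱ (Ι 0F) ⊖ᴱ ιᴱ (Ι 1F)) (ιᴱ (Ι 0F -ᴱ Ι 1F)) refl refl refl

ι-⊗ : ∀ k l → ι k ⊗ ι l ≡ ι (k * l)
ι-⊗ k l = prove𝒪 (k ∷ l ∷ []) (ιᴱ (Ι 0F) ⊗ᴱ ιᴱ (Ι 1F)) (ιᴱ (Ι 0F *ᴱ Ι 1F)) refl refl refl

θ⊖ι≡ω₂ : ∀ ν → θ ⊖ ι ν ≡ ω₂ ν
θ⊖ι≡ω₂ ν = prove𝒪 (ν ∷ []) (θᴱ ⊖ᴱ ιᴱ (Ι 0F)) (ω₂ᴱ (Ι 0F)) refl refl refl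

ω₂-⊖ : ∀ ν ν′ → ω₂ ν ⊖ ω₂ ν′ ≡ ι (ν′ - ν)
ω₂-⊖ ν ν′ = prove𝒪 (ν ∷ ν′ ∷ []) (ω₂ᴱ (Ι 0F) ⊖ᴱ ω₂ᴱ (Ι 1F)) (ιᴱ (Ι 1F -ᴱ Ι 0F)) refl refl refl

ω₃-⊖ : ∀ μ μ′ → ω₃ μ ⊖ ω₃ μ′ ≡ ι (μ′ - μ)
ω₃-⊖ μ μ′ = prove𝒪 (μ ∷ μ′ ∷ []) (ω₃ᴱ (Ι 0F) ⊖ᴱ ω₃ᴱ (Ι 1F)) (ιᴱ (Ι 1F -ᴱ Ι 0F)) refl refl refl

ω₃-factorisation : ∀ ν → (θ ⊕ ι ν) ⊗ ω₂ ν ≡ ω₃ (ν * ν)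
ω₃-factorisation ν =
  prove𝒪 (ν ∷ []) ((θᴱ ⊕ᴱ ιᴱ (Ι 0F)) ⊗ᴱ ω₂ᴱ (Ι 0F)) (ω₃ᴱ (Ι 0F *ᴱ Ι 0F)) refl refl refl

ν³-2-factorisation : ∀ ν → (θ² ⊕ ν · θ ⊕ ι (ν * ν)) ⊗ ⊝ ω₂ ν ≡ ι (ν * ν * ν - + 2)
ν³-2-factorisation ν = prove𝒪 (ν ∷ [])
  ((θ²ᴱ ⊕ᴱ Ι 0F ·ᴱ θᴱ ⊕ᴱ ιᴱ (Ι 0F *ᴱ Ι 0F)) ⊗ᴱ ⊝ᴱ ω₂ᴱ (Ι 0F))
  (ιᴱ (Ι 0F *ᴱ Ι 0F *ᴱ Ι 0F -ᴱ Κ (+ 2))) refl refl refl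

comb-coordinates : ∀ M ν μ x y z →
  comb x y z (ι M) (ω₂ ν) (ω₃ μ) ≡ ⟨ x * M - y * ν - z * μ , y , z ⟩
comb-coordinates M ν μ x y z = prove𝒪 (M ∷ ν ∷ μ ∷ x ∷ y ∷ z ∷ [])
  (combᴱ (Ι 3F) (Ι 4F) (Ι 5F) (ιᴱ (Ι 0F)) (ω₂ᴱ (Ι 1F)) (ω₃ᴱ (Ι 2F)))
  ⟪ Ι 3F *ᴱ Ι 0F -ᴱ Ι 4F *ᴱ Ι 1F -ᴱ Ι 5F *ᴱ Ι 2F , Ι 4F , Ι 5F ⟫ refl refl refl

g⊖ι-identity : ∀ a b g →
  g ⊗ (ι (+ 1) ⊖ a · g) ⊕ ι a ⊗ (g ⊗ g ⊖ b · g) ⊖ ι b ⊗ (ι (+ 1) ⊖ a · g) ≡ g ⊖ ι b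
g⊖ι-identity a b ⟨ p , q , r ⟩ = prove𝒪 (a ∷ b ∷ p ∷ q ∷ r ∷ [])
  (g ⊗ᴱ (ιᴱ (Κ (+ 1)) ⊖ᴱ Ι 0F ·ᴱ g) ⊕ᴱ ιᴱ (Ι 0F) ⊗ᴱ (g ⊗ᴱ g ⊖ᴱ Ι 1F ·ᴱ g)
    ⊖ᴱ ιᴱ (Ι 1F) ⊗ᴱ (ιᴱ (Κ (+ 1)) ⊖ᴱ Ι 0F ·ᴱ g))
  (g ⊖ᴱ ιᴱ (Ι 1F)) refl refl refl
  where
  g : 𝒪-Expr 5
  g = 𝒪-var 2F 3F 4F

ι⊗[g⊖ι]≡·⊖ι : ∀ k b g → ι k ⊗ (g ⊖ ι b) ≡ k · g ⊖ ι (k * b)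
ι⊗[g⊖ι]≡·⊖ι k b ⟨ p , q , r ⟩ = prove𝒪 (k ∷ b ∷ p ∷ q ∷ r ∷ [])
  (ιᴱ (Ι 0F) ⊗ᴱ (g ⊖ᴱ ιᴱ (Ι 1F))) (Ι 0F ·ᴱ g ⊖ᴱ ιᴱ (Ι 0F *ᴱ Ι 1F)) refl refl refl
  where
  g : 𝒪-Expr 5
  g = 𝒪-var 2F 3F 4F

ev : ℤ → ℤ → 𝒪 → ℤ
ev ν μ ⟨ a , b , c ⟩ = a + b * ν + c * μ

evᴱ : ∀ {n} → Expr ℤ n → Expr ℤ n → 𝒪-Expr n → Expr ℤ n
evᴱ ν μ ⟪ a , b , c ⟫ = a +ᴱ b *ᴱ ν +ᴱ c *ᴱ μ

ev-ι : ∀ ν μ k → ev ν μ (ι k) ≡ k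
ev-ι ν μ k = prove (ν ∷ μ ∷ k ∷ []) (evᴱ (Ι 0F) (Ι 1F) (ιᴱ (Ι 2F))) (Ι 2F) refl

ev-⊕ : ∀ ν μ x y → ev ν μ (x ⊕ y) ≡ ev ν μ x + ev ν μ y
ev-⊕ ν μ ⟨ a , b , c ⟩ ⟨ d , e , f ⟩ = prove (ν ∷ μ ∷ a ∷ b ∷ c ∷ d ∷ e ∷ f ∷ [])
  (evᴱ (Ι 0F) (Ι 1F) (x ⊕ᴱ y)) (evᴱ (Ι 0F) (Ι 1F) x +ᴱ evᴱ (Ι 0F) (Ι 1F) y) refl
  where
  x y : 𝒪-Expr 8
  x = 𝒪-var 2F 3F 4F
  y = 𝒪-var 5F 6F 7F

ev-⊗ : ∀ ν x y → ev ν (ν * ν) (x ⊗ y) ≡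
  ev ν (ν * ν) x * ev ν (ν * ν) y - (b x * c y + c x * b y + c x * c y * ν) * (ν * ν * ν - + 2)
ev-⊗ ν ⟨ a , b , c ⟩ ⟨ d , e , f ⟩ = prove (ν ∷ a ∷ b ∷ c ∷ d ∷ e ∷ f ∷ [])
  (evᴱ ν′ ν²′ (x ⊗ᴱ y))
  (evᴱ ν′ ν²′ x *ᴱ evᴱ ν′ ν²′ y
    -ᴱ (Ι 2F *ᴱ Ι 6F +ᴱ Ι 3F *ᴱ Ι 5F +ᴱ Ι 3F *ᴱ Ι 6F *ᴱ ν′) *ᴱ (ν′ *ᴱ ν′ *ᴱ ν′ -ᴱ Κ (+ 2)))
  refl
  where
  ν′ ν²′ : Expr ℤ 7
  ν′ = Ι 0F
  ν²′ = ν′ *ᴱ ν′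
  x y : 𝒪-Expr 7
  x = 𝒪-var 1F 2F 3F
  y = 𝒪-var 4F 5F 6F

ev-comb : ∀ M ν μ x y z → ev ν μ (comb x y z (ι M) (ω₂ ν) (ω₃ μ)) ≡ x * M
ev-comb M ν μ x y z = prove (M ∷ ν ∷ μ ∷ x ∷ y ∷ z ∷ [])
  (evᴱ (Ι 1F) (Ι 2F) (combᴱ (Ι 3F) (Ι 4F) (Ι 5F) (ιᴱ (Ι 0F)) (ω₂ᴱ (Ι 1F)) (ω₃ᴱ (Ι 2F))))
  (Ι 3F *ᴱ Ι 0F) refl

ev-[x⊖ev·1] : ∀ ν μ x → ev ν μ (x ⊖ ev ν μ x · ι (+ 1)) ≡ + 0
ev-[x⊖ev·1] ν μ ⟨ a , b , c ⟩ = prove (ν ∷ μ ∷ a ∷ b ∷ c ∷ [])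
  (evᴱ (Ι 0F) (Ι 1F) (x ⊖ᴱ evᴱ (Ι 0F) (Ι 1F) x ·ᴱ ιᴱ (Κ (+ 1)))) (Κ (+ 0)) refl
  where
  x : 𝒪-Expr 5
  x = 𝒪-var 2F 3F 4F

v⊖[bω₂⊕cω₃]≡ev : ∀ ν μ v → v ⊖ (b v · ω₂ ν ⊕ c v · ω₃ μ) ≡ ι (ev ν μ v)
v⊖[bω₂⊕cω₃]≡ev ν μ ⟨ a , b , c ⟩ = prove𝒪 (ν ∷ μ ∷ a ∷ b ∷ c ∷ [])
  (v ⊖ᴱ (Ι 3F ·ᴱ ω₂ᴱ (Ι 0F) ⊕ᴱ Ι 4F ·ᴱ ω₃ᴱ (Ι 1F))) (ιᴱ (evᴱ (Ι 0F) (Ι 1F) v)) refl refl refl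
  where
  v : 𝒪-Expr 5
  v = 𝒪-var 2F 3F 4F

∈Span⇒∣ev : ∀ M ν μ v → Span (ι M) (ω₂ ν) (ω₃ μ) v → M Signed.∣ ev ν μ v
∈Span⇒∣ev M ν μ _ (x , y , z , refl) = divides x (ev-comb M ν μ x y z)

∣ev⇒∈Span : ∀ M ν μ v → M Signed.∣ ev ν μ v → Span (ι M) (ω₂ ν) (ω₃ μ) v
∣ev⇒∈Span M ν μ ⟨ a , b , c ⟩ (divides q a+bν+cμ≡qM) =
  q , b , c , trans (cong (λ t → ⟨ t , b , c ⟩) a≡qM-bν-cμ) (sym (comb-coordinates M ν μ q b c))
  where
  open ≡-Reasoning
  a≡a+bν+cμ-bν-cμ : a ≡ a + b * ν + c * μ - b * ν - c * μ
  a≡a+bν+cμ-bν-cμ = prove (a ∷ b ∷ c ∷ ν ∷ μ ∷ [])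
    (Ι 0F) (Ι 0F +ᴱ Ι 1F *ᴱ Ι 3F +ᴱ Ι 2F *ᴱ Ι 4F -ᴱ Ι 1F *ᴱ Ι 3F -ᴱ Ι 2F *ᴱ Ι 4F) refl
  a≡qM-bν-cμ : a ≡ q * M - b * ν - c * μ
  a≡qM-bν-cμ = begin
    a                                   ≡⟨ a≡a+bν+cμ-bν-cμ ⟩
    a + b * ν + c * μ - b * ν - c * μ   ≡⟨ cong (λ t → t - b * ν - c * μ) a+bν+cμ≡qM ⟩
    q * M - b * ν - c * μ               ∎

comb-independent : ∀ M ν μ → M ≢ + 0 → ∀ x y z →
  comb x y z (ι M) (ω₂ ν) (ω₃ μ) ≡ 𝟎 → x ≡ + 0 × y ≡ + 0 × z ≡ + 0
comb-independent M ν μ M≢0 x y z comb≡𝟎 =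
  fromInj₁ (⊥-elim ∘ M≢0) (ℤₚ.i*j≡0⇒i≡0∨j≡0 x x*M≡0) , cong b coordinates≡𝟎 , cong c coordinates≡𝟎
  where
  coordinates≡𝟎 : ⟨ x * M - y * ν - z * μ , y , z ⟩ ≡ 𝟎
  coordinates≡𝟎 = trans (sym (comb-coordinates M ν μ x y z)) comb≡𝟎
  x*M≡0 : x * M ≡ + 0
  x*M≡0 = trans (sym (ev-comb M ν μ x y z)) (trans (cong (ev ν μ) comb≡𝟎) (ev-ι ν μ (+ 0)))

n≡m+n-m : ∀ m n → n ≡ m + n - m
n≡m+n-m = solve-∀

_∩ℤ : Subset𝒪 → ℤ → Set
(I ∩ℤ) k = I (ι k)

module IdealProperties {I : Subset𝒪} (ideal : IsIdeal I) where
  open IsIdeal ideal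

  ⊝-∈ : ∀ {x} → I x → I (⊝ x)
  ⊝-∈ {x} x∈I = subst I (-1⊗x≡⊝x x) (mul∈ (ι (- + 1)) x∈I)

  ⊖-∈ : ∀ {x y} → I x → I y → I (x ⊖ y)
  ⊖-∈ x∈I y∈I = add∈ x∈I (⊝-∈ y∈I)

  ≡[I]-sym : ∀ x y → x ≡[ I ] y → y ≡[ I ] x
  ≡[I]-sym x y x≡y = subst I (⊝[x⊖y]≡y⊖x x y) (⊝-∈ x≡y)

  ≡[I]-trans : ∀ x y z → x ≡[ I ] y → y ≡[ I ] z → x ≡[ I ] z
  ≡[I]-trans x y z x≡y y≡z = subst I ([x⊖y]⊕[y⊖z]≡x⊖z x y z) (add∈ x≡y y≡z)

  ∈-resp-≡[I] : ∀ x y → I x → x ≡[ I ] y → I y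
  ∈-resp-≡[I] x y x∈I x≡y = subst I (x⊖[x⊖y]≡y x y) (⊖-∈ x∈I x≡y)

  ∩ℤ-* : ∀ k {l} → (I ∩ℤ) l → (I ∩ℤ) (k * l)
  ∩ℤ-* k {l} l∈I = subst I (ι-⊗ k l) (mul∈ (ι k) l∈I)

  ∩ℤ⇒≡[I]-%ℕ : ∀ {d} .{{_ : NonZero d}} → (I ∩ℤ) (+ d) → ∀ k → ι k ≡[ I ] ι (+ (k %ℕ d))
  ∩ℤ⇒≡[I]-%ℕ {d} d∈I k =
    subst I (sym (ι-⊖ k (+ (k %ℕ d)))) (subst (I ∩ℤ) [k/d]*d≡k-[k%d] (∩ℤ-* (k /ℕ d) d∈I))
    where
    open ≡-Reasoning
    [k/d]*d≡k-[k%d] : (k /ℕ d) * + d ≡ k - + (k %ℕ d)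
    [k/d]*d≡k-[k%d] = begin
      (k /ℕ d) * + d                                ≡⟨ n≡m+n-m (+ (k %ℕ d)) ((k /ℕ d) * + d) ⟩
      + (k %ℕ d) + (k /ℕ d) * + d - + (k %ℕ d)     ≡⟨ cong (_- + (k %ℕ d)) (a≡a%ℕn+[a/ℕn]*n k d) ⟨
      k - + (k %ℕ d)                                ∎

  ev∈∩ℤ : ∀ {ν μ v} → I (ω₂ ν) → I (ω₃ μ) → I v → (I ∩ℤ) (ev ν μ v)
  ev∈∩ℤ {ν} {μ} {v} ω₂∈I ω₃∈I v∈I =
    subst I (v⊖[bω₂⊕cω₃]≡ev ν μ v) (⊖-∈ v∈I (add∈ (mul∈ (ι (b v)) ω₂∈I) (mul∈ (ι (c v)) ω₃∈I)))

QuotientCyclic⇒≡[I]-integer : ∀ {I} → IsIdeal I → QuotientCyclic I → ∀ x → ∃ λ k → x ≡[ I ] ι k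
QuotientCyclic⇒≡[I]-integer {I} ideal (g , ≡-multiple) x
  with ≡-multiple (ι (+ 1)) | ≡-multiple (g ⊗ g) | ≡-multiple x
... | a , 1≡ag | b , g²≡bg | k , x≡kg = k * b , ≡[I]-trans x (k · g) (ι (k * b)) x≡kg kg≡kb
  where
  open IsIdeal ideal
  open IdealProperties ideal
  g≡b : g ≡[ I ] ι b
  g≡b = subst I (g⊖ι-identity a b g) (⊖-∈ (add∈ (mul∈ g 1≡ag) (mul∈ (ι a) g²≡bg)) (mul∈ (ι b) 1≡ag))
  kg≡kb : (k · g) ≡[ I ] ι (k * b)
  kg≡kb = subst I (ι⊗[g⊖ι]≡·⊖ι k b g) (mul∈ (ι k) g≡b)

module IndexProperties {I : Subset𝒪} (ideal : IsIdeal I)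
    (≡-integer : ∀ x → ∃ λ k → x ≡[ I ] ι k) {m : ℕ} (index : Index I m) where
  open IdealProperties ideal

  private
    r : Fin m → 𝒪
    r = proj₁ index
    r-injective : ∀ i j → r i ≡[ I ] r j → i ≡ j
    r-injective = proj₁ (proj₂ index)
    r-surjective : ∀ x → ∃ λ i → x ≡[ I ] r i
    r-surjective = proj₂ (proj₂ index)

    class : ℕ → Fin m
    class n = proj₁ (r-surjective (ι (+ n)))
    ι≡r-class : ∀ n → ι (+ n) ≡[ I ] r (class n)
    ι≡r-class n = proj₂ (r-surjective (ι (+ n)))

  ∩ℤ⇒index≤ : ∀ d .{{_ : NonZero d}} → (I ∩ℤ) (+ d) → m ℕ.≤ d
  ∩ℤ⇒index≤ d d∈I = Finₚ.injective⇒≤ residue-injective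
    where
    integer : Fin m → ℤ
    integer i = proj₁ (≡-integer (r i))
    remainder : Fin m → ℕ
    remainder i = integer i %ℕ d
    r≡remainder : ∀ i → r i ≡[ I ] ι (+ remainder i)
    r≡remainder i = ≡[I]-trans (r i) (ι (integer i)) (ι (+ remainder i))
      (proj₂ (≡-integer (r i))) (∩ℤ⇒≡[I]-%ℕ d∈I (integer i))
    residue : Fin m → Fin d
    residue i = fromℕ< (n%ℕd<d (integer i) d)
    residue-injective : ∀ {i j} → residue i ≡ residue j → i ≡ j
    residue-injective {i} {j} same =
      r-injective i j (≡[I]-trans (r i) (ι (+ remainder i)) (r j) (r≡remainder i) remainder≡r)
      where
      remainder≡r : ι (+ remainder i) ≡[ I ] r j
      remainder≡r = subst (λ t → ι (+ t) ≡[ I ] r j) (Finₚ.fromℕ<-injective _ _ _ _ (sym same))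
        (≡[I]-sym (r j) (ι (+ remainder j)) (r≡remainder j))

  ∃-positive-∩ℤ-≤index : ∃ λ d → NonZero d × d ℕ.≤ m × (I ∩ℤ) (+ d)
  ∃-positive-∩ℤ-≤index with Finₚ.pigeonhole (ℕₚ.n<1+n m) (class ∘ toℕ)
  ... | i , j , i<j , same-class =
      toℕ j ∸ toℕ i
    , ℕ.>-nonZero (ℕₚ.m<n⇒0<n∸m i<j)
    , ℕₚ.≤-trans (ℕₚ.m∸n≤m (toℕ j) (toℕ i)) (Finₚ.toℕ≤pred[n] j)
    , subst (I ∩ℤ) j-i≡j∸i (subst I (ι-⊖ (+ toℕ j) (+ toℕ i)) j≡i)
    where
    j≡i : ι (+ toℕ j) ≡[ I ] ι (+ toℕ i)
    j≡i = ≡[I]-trans (ι (+ toℕ j)) (r (class (toℕ i))) (ι (+ toℕ i))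
      (subst (λ k → ι (+ toℕ j) ≡[ I ] r k) (sym same-class) (ι≡r-class (toℕ j)))
      (≡[I]-sym (ι (+ toℕ i)) (r (class (toℕ i))) (ι≡r-class (toℕ i)))
    j-i≡j∸i : + toℕ j - + toℕ i ≡ + (toℕ j ∸ toℕ i)
    j-i≡j∸i = trans (ℤₚ.m-n≡m⊖n (toℕ j) (toℕ i)) (ℤₚ.⊖-≥ (ℕₚ.<⇒≤ i<j))

  index-nonZero×∩ℤ : NonZero m × (I ∩ℤ) (+ m)
  index-nonZero×∩ℤ = positive⇒index ∃-positive-∩ℤ-≤index
    where
    positive⇒index : (∃ λ d → NonZero d × d ℕ.≤ m × (I ∩ℤ) (+ d)) → NonZero m × (I ∩ℤ) (+ m)
    positive⇒index (d , d≢0 , d≤m , d∈I) =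
      subst (λ n → NonZero n × (I ∩ℤ) (+ n)) (ℕₚ.≤-antisym d≤m (∩ℤ⇒index≤ d {{d≢0}} d∈I)) (d≢0 , d∈I)

  index-nonZero : NonZero m
  index-nonZero = proj₁ index-nonZero×∩ℤ

  index∈∩ℤ : (I ∩ℤ) (+ m)
  index∈∩ℤ = proj₂ index-nonZero×∩ℤ

  ∩ℤ-<index⇒≡0 : ∀ n → n ℕ.< m → (I ∩ℤ) (+ n) → n ≡ 0
  ∩ℤ-<index⇒≡0 zero    _   _   = refl
  ∩ℤ-<index⇒≡0 (suc n) n<m n∈I = ⊥-elim (ℕₚ.<⇒≱ n<m (∩ℤ⇒index≤ (suc n) n∈I))

  -- The instance and m ∈ I are taken as arguments rather than from index-nonZero×∩ℤ, so that
  -- the type checker never unfolds that proof when comparing remainders modulo m.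
  ∩ℤ⇒index∣ : .{{_ : NonZero m}} → (I ∩ℤ) (+ m) → ∀ {k} → (I ∩ℤ) k → + m ∣ k
  ∩ℤ⇒index∣ m∈I {k} k∈I = Signed.∣⇒∣ᵤ (divides (k /ℕ m) (begin
    k                             ≡⟨ a≡a%ℕn+[a/ℕn]*n k m ⟩
    + (k %ℕ m) + (k /ℕ m) * + m   ≡⟨ cong (λ t → + t + (k /ℕ m) * + m) k%m≡0 ⟩
    + 0 + (k /ℕ m) * + m          ≡⟨ ℤₚ.+-identityˡ _ ⟩
    (k /ℕ m) * + m                ∎))
    where
    open ≡-Reasoning
    k%m∈I : (I ∩ℤ) (+ (k %ℕ m))
    k%m∈I = ∈-resp-≡[I] (ι k) (ι (+ (k %ℕ m))) k∈I (∩ℤ⇒≡[I]-%ℕ m∈I k)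
    k%m≡0 : k %ℕ m ≡ 0
    k%m≡0 = ∩ℤ-<index⇒≡0 (k %ℕ m) (n%ℕd<d k m) k%m∈I

module Basis {I : Subset𝒪} (ideal : IsIdeal I)
    (≡-integer : ∀ x → ∃ λ k → x ≡[ I ] ι k) {m : ℕ} (index : Index I m) where
  open IsIdeal ideal
  open IdealProperties ideal
  open IndexProperties ideal ≡-integer index

  ∣m : ∀ {k} → (I ∩ℤ) k → + m ∣ k
  ∣m = ∩ℤ⇒index∣ {{index-nonZero}} index∈∩ℤ

  ν : ℤ
  ν = proj₁ (≡-integer θ)

  ω₂∈I : I (ω₂ ν)
  ω₂∈I = subst I (θ⊖ι≡ω₂ ν) (proj₂ (≡-integer θ))

  ω₃∈I : I (ω₃ (ν * ν))
  ω₃∈I = subst I (ω₃-factorisation ν) (mul∈ (θ ⊕ ι ν) ω₂∈I)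

  ν³≡2 : ν * ν * ν ≡ + 2 [mod m ]
  ν³≡2 = ∣m (subst I (ν³-2-factorisation ν) (mul∈ (θ² ⊕ ν · θ ⊕ ι (ν * ν)) (⊝-∈ ω₂∈I)))

  isZBasis : IsZBasis I (ω₁ m) (ω₂ ν) (ω₃ (ν * ν))
  isZBasis = (index∈∩ℤ , ω₂∈I , ω₃∈I)
           , (λ v v∈I → ∣ev⇒∈Span (+ m) ν (ν * ν) v (Signed.∣ᵤ⇒∣ (∣m (ev∈∩ℤ ω₂∈I ω₃∈I v∈I))))
           , comb-independent (+ m) ν (ν * ν) (ℕ.≢-nonZero⁻¹ m {{index-nonZero}} ∘ ℤₚ.+-injective)

  isZBasis-unique : ∀ ν′ μ′ → IsZBasis I (ω₁ m) (ω₂ ν′) (ω₃ μ′) →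
    (ν′ ≡ ν [mod m ]) × (μ′ ≡ ν * ν [mod m ])
  isZBasis-unique ν′ μ′ ((_ , ω₂′∈I , ω₃′∈I) , _) =
      ∣m (subst I (ω₂-⊖ ν ν′) (⊖-∈ ω₂∈I ω₂′∈I))
    , ∣m (subst I (ω₃-⊖ (ν * ν) μ′) (⊖-∈ ω₃∈I ω₃′∈I))

module Converse (m : ℕ) (ν : ℤ) (ν³≡2 : ν * ν * ν ≡ + 2 [mod m ]) where
  L : Subset𝒪
  L = Span (ω₁ m) (ω₂ ν) (ω₃ (ν * ν))

  ∈L⇒∣ev : ∀ v → L v → + m Signed.∣ ev ν (ν * ν) v
  ∈L⇒∣ev = ∈Span⇒∣ev (+ m) ν (ν * ν)

  ∣ev⇒∈L : ∀ v → + m Signed.∣ ev ν (ν * ν) v → L v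
  ∣ev⇒∈L = ∣ev⇒∈Span (+ m) ν (ν * ν)

  ev≡⇒∈L : ∀ v {k} → ev ν (ν * ν) v ≡ k → + m Signed.∣ k → L v
  ev≡⇒∈L v ev≡k m∣k = ∣ev⇒∈L v (subst (+ m Signed.∣_) (sym ev≡k) m∣k)

  isIdeal : IsIdeal L
  isIdeal = record
    { zero∈ = ev≡⇒∈L 𝟎 (ev-ι ν (ν * ν) (+ 0)) (divides (+ 0) refl)
    ; add∈  = λ {x} {y} x∈L y∈L → ev≡⇒∈L (x ⊕ y) (ev-⊕ ν (ν * ν) x y)
                (Signed.∣m∣n⇒∣m+n (∈L⇒∣ev x x∈L) (∈L⇒∣ev y y∈L))
    ; mul∈  = λ r {x} x∈L → ev≡⇒∈L (r ⊗ x) (ev-⊗ ν r x)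
                (Signed.∣m∣n⇒∣m-n (Signed.∣n⇒∣m*n (ev ν (ν * ν) r) (∈L⇒∣ev x x∈L))
                                  (Signed.∣n⇒∣m*n (b r * c x + c r * b x + c r * c x * ν) (Signed.∣ᵤ⇒∣ ν³≡2)))
    }

  isPrimitive : .{{_ : NonZero m}} → Primitive L
  isPrimitive = (isIdeal , ι (+ m) , m∈L , ℕ.≢-nonZero⁻¹ m ∘ ℤₚ.+-injective ∘ cong a)
              , ι (+ 1) , λ x → ev ν (ν * ν) x , ev≡⇒∈L _ (ev-[x⊖ev·1] ν (ν * ν) x) (divides (+ 0) refl)
    where
    m∈L : L (ι (+ m))
    m∈L = ev≡⇒∈L (ι (+ m)) (ev-ι ν (ν * ν) (+ m)) Signed.∣-refl

lemma1 : ( ∀ (I : Subset𝒪) (m : ℕ) → Primitive I → Index I m →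
    ∃ λ (ν : ℤ) →
    (ν * ν * ν ≡ + 2 [mod m ])
    × IsZBasis I (ω₁ m) (ω₂ ν) (ω₃ (ν * ν))
    × (∀ (ν′ μ′ : ℤ) → ν′ * ν′ * ν′ ≡ + 2 [mod m ] → μ′ ≡ ν′ * ν′ [mod m ] →
    IsZBasis I (ω₁ m) (ω₂ ν′) (ω₃ μ′) →
    (ν′ ≡ ν [mod m ]) × (μ′ ≡ ν * ν [mod m ])) )
    ×
    ( ∀ (m : ℕ) → NonZero m → ∀ (ν : ℤ) → ν * ν * ν ≡ + 2 [mod m ] →
    Primitive (Span (ω₁ m) (ω₂ ν) (ω₃ (ν * ν))) )
lemma1 =
    (λ I m ((ideal , _) , cyclic) index →
       let open Basis ideal (QuotientCyclic⇒≡[I]-integer ideal cyclic) index in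
       ν , ν³≡2 , isZBasis , λ ν′ μ′ _ _ → isZBasis-unique ν′ μ′)
  , (λ m m≢0 ν ν³≡2 → Converse.isPrimitive m ν ν³≡2 {{m≢0}})
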